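{- For every integer $n \ge 5$, let $X_n$ be the Cayley graph of the symmetric group $S_n$ with respect to the generating set $S=\{(1,2),(2,3),\ldots,(n-1,n),(n,1)\}$ of $n$ cyclically adjacent transpositions (the modified bubble-sort graph of dimension $n$). Then the full automorphism group $\mathrm{Aut}(X_n)$ is isomorphic to the direct product $S_n \times D_{2n}$, where $D_{2n}$ is the dihedral group of order $2n$.
   Context: For a group $H$ and a subset $S \subseteq H$ with $1 \notin S = S^{ -1}$, the Cayley graph $\mathrm{Cay}(H,S)$ is the simple undirected graph with vertex set $H$ in which $h$ and $sh$ are adjacent for all $h \in H$, $s \in S$. The automorphism group of a graph is the group of all permutations of its vertex set preserving adjacency. -}

module Defs where

open import Data.Nat using (ℕ; suc; _+_; _∸_; NonZero)
open import Data.Nat.DivMod using (_mod_)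
open import Data.Fin using (Fin; toℕ)
open import Data.Fin.Permutation using (Permutation′; _⟨$⟩ʳ_; _∘ₚ_; transpose)
import Data.Fin.Permutation as P
open import Data.Bool using (Bool; true; false; if_then_else_; _xor_)
open import Data.Product using (Σ; ∃; _×_; _,_; proj₁; proj₂)
open import Relation.Binary.PropositionalEquality using (_≡_; trans)

-- The symmetric group S_n: permutations of Fin n = {0,…,n-1},
-- with (pointwise) equality _≈ₚ_ and product σ · τ = σ ∘ τ
-- (first τ, then σ).

Perm : ℕ → Set
Perm n = Permutation′ n

_≈ₚ_ : ∀ {n} → Perm n → Perm n → Set
_≈ₚ_ = P._≈_

_·_ : ∀ {n} → Perm n → Perm n → Perm n
σ · τ = τ ∘ₚ σ

-- The generating set S = {(1,2),(2,3),…,(n-1,n),(n,1)}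
-- (0-indexed: the transpositions (i, i+1 mod n), i = 0,…,n-1).

next : ∀ {n} .{{_ : NonZero n}} → Fin n → Fin n
next {n} i = suc (toℕ i) mod n

gen : ∀ {n} .{{_ : NonZero n}} → Fin n → Perm n
gen i = transpose i (next i)

InS : ∀ {n} .{{_ : NonZero n}} → Perm n → Set
InS s = ∃ λ i → s ≈ₚ gen i

Adj : ∀ {n} .{{_ : NonZero n}} → Perm n → Perm n → Set
Adj x y = ∃ λ s → InS s × (y ≈ₚ (s · x))

record Aut (n : ℕ) .{{_ : NonZero n}} : Set where
  field
    fun    : Perm n → Perm n
    inv    : Perm n → Perm n
    fun-cong : ∀ {x y} → x ≈ₚ y → fun x ≈ₚ fun y
    inv-cong : ∀ {x y} → x ≈ₚ y → inv x ≈ₚ inv y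
    fun-inv  : ∀ x → fun (inv x) ≈ₚ x
    inv-fun  : ∀ x → inv (fun x) ≈ₚ x
    adj-pres : ∀ x y → Adj x y → Adj (fun x) (fun y)
    adj-refl : ∀ x y → Adj (fun x) (fun y) → Adj x y

open Aut public

_≈ᴬ_ : ∀ {n} .{{_ : NonZero n}} → Aut n → Aut n → Set
φ ≈ᴬ ψ = ∀ x → fun φ x ≈ₚ fun ψ x

_∘ᴬ_ : ∀ {n} .{{_ : NonZero n}} → Aut n → Aut n → Aut n
φ ∘ᴬ ψ = record
  { fun = λ x → fun φ (fun ψ x)
  ; inv = λ x → inv ψ (inv φ x)
  ; fun-cong = λ e → fun-cong φ (fun-cong ψ e)
  ; inv-cong = λ e → inv-cong ψ (inv-cong φ e)
  ; fun-inv = λ x i → trans (fun-cong φ (fun-inv ψ (inv φ x)) i) (fun-inv φ x i)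
  ; inv-fun = λ x i → trans (inv-cong ψ (inv-fun φ (fun ψ x)) i) (inv-fun ψ x i)
  ; adj-pres = λ x y a → adj-pres φ _ _ (adj-pres ψ x y a)
  ; adj-refl = λ x y a → adj-refl ψ x y (adj-refl φ _ _ a)
  }

-- The dihedral group D_{2n} of order 2n: elements (e , a) with
-- e : Bool, a : Fin n, standing for r^a s^e where r^n = s^2 = 1 and
-- s r s = r⁻¹.  Product: r^a s^e · r^b s^f = r^(a ± b) s^(e+f),
-- with sign − iff e = true.

Dih : ℕ → Set
Dih n = Bool × Fin n

_⋆_ : ∀ {n} .{{_ : NonZero n}} → Dih n → Dih n → Dih n
_⋆_ {n} (e , a) (f , b) =
  (e xor f) , ((toℕ a + (if e then n ∸ toℕ b else toℕ b)) mod n)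

_≈ˣ_ : ∀ {n} → Perm n × Dih n → Perm n × Dih n → Set
(σ , d) ≈ˣ (τ , d′) = (σ ≈ₚ τ) × (d ≡ d′)

_⊗_ : ∀ {n} .{{_ : NonZero n}} → Perm n × Dih n → Perm n × Dih n → Perm n × Dih n
(σ , d) ⊗ (τ , d′) = (σ · τ) , (d ⋆ d′)

record AutIso (n : ℕ) .{{_ : NonZero n}} : Set where
  field
    Φ      : Aut n → Perm n × Dih n
    Φ-cong : ∀ {φ ψ} → φ ≈ᴬ ψ → Φ φ ≈ˣ Φ ψ
    Φ-hom  : ∀ φ ψ → Φ (φ ∘ᴬ ψ) ≈ˣ (Φ φ ⊗ Φ ψ)
    Φ-inj  : ∀ {φ ψ} → Φ φ ≈ˣ Φ ψ → φ ≈ᴬ ψ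
    Φ-surj : ∀ y → ∃ λ φ → Φ φ ≈ˣ y

module Submission where

-- Write t i for the transposition (i, i+1 mod n). For n ≥ 5 an equation t a t b = t c t d holds only
-- trivially (a = b and c = d, or a = c and b = d, or the two factors commute and appear swapped), so the
-- 4-cycles of X n are exactly the squares spanned by commuting generators, and t i, t (i+1) never commute.
-- An automorphism fixing 1 and its neighbours t i therefore fixes the neighbours of every neighbour, and
-- hence all of S n, which the t i generate. A general automorphism φ sends the neighbours t i of 1 to the
-- neighbours t (f i) · φ 1 of φ 1, and the 4-cycle argument shows that f moves cyclically adjacent indices
-- to adjacent ones; so f is a symmetry of the n-cycle, i.e. a dihedral map δ p. The dihedral permutation
-- dih p conjugates each t i to t (δ p i), so correcting φ by dih p on the left and by φ 1 on the right
-- gives a rigid automorphism; thus φ x = dih p · x · c, and φ ↦ (c⁻¹, p) is the isomorphism.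

open import Algebra.Bundles using (AbelianGroup; Group)
open import Algebra.Consequences.Propositional using (comm∧idʳ⇒id; comm∧invʳ⇒inv)
import Algebra.Properties.AbelianGroup as AbelianGroupProperties
import Algebra.Properties.CommutativeSemigroup as CommutativeSemigroupProperties
import Algebra.Properties.Group as GroupProperties
open import Data.Bool using (Bool; true; false; not)
open import Data.Empty using (⊥; ⊥-elim)
open import Data.Fin using (Fin; toℕ; zero; _≟_)
open import Data.Fin.Permutation using (_⟨$⟩ʳ_; transpose; inverseˡ; inverseʳ)
import Data.Fin.Permutation as P
import Data.Fin.Permutation.Transposition.List as TL
open import Data.Fin.Properties using (toℕ-injective; toℕ-fromℕ<; toℕ<n)
open import Data.List using (List; []; _∷_; _++_)
open import Data.Nat as ℕ using (ℕ; _≤_; NonZero; _+_; _∸_; _%_; _<_; s≤s; z≤n)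
open import Data.Nat.DivMod using (_mod_; %-distribˡ-+; m%n%n≡m%n; n%n≡0; m%n<n; m<n⇒m%n≡m)
open import Data.Nat.Properties using (+-comm; +-assoc; +-identityʳ; m+[n∸m]≡n; <⇒≤; <⇒≢; <-trans; n<1+n)
open import Data.Product using (_×_; _,_; ∃; proj₁; proj₂)
open import Data.Sum using (_⊎_; inj₁; inj₂)
open import Defs
open import Relation.Binary.PropositionalEquality
import Relation.Binary.Reasoning.Setoid as SetoidReasoning
open import Relation.Nullary using (¬_; Dec; yes; no)

module Cyclic (m : ℕ) where
  n : ℕ
  n = ℕ.suc m

  fin : ℕ → Fin n
  fin a = a mod n

  toℕ-fin : ∀ a → toℕ (fin a) ≡ a % n
  toℕ-fin a = toℕ-fromℕ< (m%n<n a n)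

  fin-cong-% : ∀ a b → a % n ≡ b % n → fin a ≡ fin b
  fin-cong-% a b e = toℕ-injective (trans (toℕ-fin a) (trans e (sym (toℕ-fin b))))

  fin-toℕ : ∀ i → fin (toℕ i) ≡ i
  fin-toℕ i = toℕ-injective (trans (toℕ-fin (toℕ i)) (m<n⇒m%n≡m (toℕ<n i)))

  fin-+ˡ : ∀ a b → fin (toℕ (fin a) + b) ≡ fin (a + b)
  fin-+ˡ a b = fin-cong-% (toℕ (fin a) + b) (a + b) (begin
    (toℕ (fin a) + b) % n ≡⟨ cong (λ v → (v + b) % n) (toℕ-fin a) ⟩
    (a % n + b) % n       ≡⟨ %-distribˡ-+ (a % n) b n ⟩
    (a % n % n + b % n) % n ≡⟨ cong (λ v → (v + b % n) % n) (m%n%n≡m%n a n) ⟩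
    (a % n + b % n) % n   ≡⟨ %-distribˡ-+ a b n ⟨
    (a + b) % n           ∎)
    where open ≡-Reasoning

  fin-+ʳ : ∀ a b → fin (a + toℕ (fin b)) ≡ fin (a + b)
  fin-+ʳ a b = begin
    fin (a + toℕ (fin b)) ≡⟨ cong fin (+-comm a _) ⟩
    fin (toℕ (fin b) + a) ≡⟨ fin-+ˡ b a ⟩
    fin (b + a)           ≡⟨ cong fin (+-comm b a) ⟩
    fin (a + b)           ∎
    where open ≡-Reasoning

  infixl 6 _⊕_
  _⊕_ : Fin n → Fin n → Fin n
  i ⊕ j = fin (toℕ i + toℕ j)

  ⊖_ : Fin n → Fin n
  ⊖ i = fin (n ∸ toℕ i)

  ⊕-comm : ∀ i j → i ⊕ j ≡ j ⊕ i
  ⊕-comm i j = cong fin (+-comm (toℕ i) (toℕ j))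

  ⊕-assoc : ∀ i j l → (i ⊕ j) ⊕ l ≡ i ⊕ (j ⊕ l)
  ⊕-assoc i j l = begin
    fin (toℕ (fin (toℕ i + toℕ j)) + toℕ l) ≡⟨ fin-+ˡ (toℕ i + toℕ j) (toℕ l) ⟩
    fin (toℕ i + toℕ j + toℕ l)             ≡⟨ cong fin (+-assoc (toℕ i) _ _) ⟩
    fin (toℕ i + (toℕ j + toℕ l))           ≡⟨ fin-+ʳ (toℕ i) _ ⟨
    fin (toℕ i + toℕ (fin (toℕ j + toℕ l))) ∎
    where open ≡-Reasoning

  ⊕-identityʳ : ∀ i → i ⊕ zero ≡ i
  ⊕-identityʳ i = trans (cong fin (+-identityʳ (toℕ i))) (fin-toℕ i)

  ⊕-inverseʳ : ∀ i → i ⊕ ⊖ i ≡ zero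
  ⊕-inverseʳ i = begin
    fin (toℕ i + toℕ (fin (n ∸ toℕ i))) ≡⟨ fin-+ʳ (toℕ i) _ ⟩
    fin (toℕ i + (n ∸ toℕ i))           ≡⟨ cong fin (m+[n∸m]≡n (<⇒≤ (toℕ<n i))) ⟩
    fin n                               ≡⟨ fin-cong-% n 0 (n%n≡0 n) ⟩
    zero                                ∎
    where open ≡-Reasoning

  ℤₙ : AbelianGroup _ _
  ℤₙ = record
    { _≈_ = _≡_ ; _∙_ = _⊕_ ; ε = zero ; _⁻¹ = ⊖_
    ; isAbelianGroup = record
      { isGroup = record
        { isMonoid = record
          { isSemigroup = record
            { isMagma = record { isEquivalence = isEquivalence ; ∙-cong = cong₂ _⊕_ }
            ; assoc = ⊕-assoc }
          ; identity = comm∧idʳ⇒id ⊕-comm ⊕-identityʳ }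
        ; inverse = comm∧invʳ⇒inv ⊕-comm ⊕-inverseʳ
        ; ⁻¹-cong = cong ⊖_ }
      ; comm = ⊕-comm } }

  open AbelianGroup ℤₙ public using ()
    renaming (identityˡ to ⊕-identityˡ; inverseˡ to ⊕-inverseˡ)
  open AbelianGroupProperties ℤₙ public using ()
    renaming (∙-cancelʳ to ⊕-cancelʳ; ⁻¹-involutive to ⊖-involutive; ⁻¹-∙-comm to ⊖-⊕-comm;
              ε⁻¹≈ε to ⊖-zero; \\-leftDividesˡ to ⊕-⊖-cancel; \\-leftDividesʳ to ⊖-⊕-cancel;
              ⁻¹-anti-homo‿- to ⊖-⊝; xyx⁻¹≈y to ⊕-⊝-cancel; //-rightDividesʳ to ⊕-⊝-cancelʳ;
              //-rightDividesˡ to ⊝-⊕-cancel)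
  open CommutativeSemigroupProperties (AbelianGroup.commutativeSemigroup ℤₙ) public using ()
    renaming (xy∙z≈xz∙y to ⊕-⊝-comm)

  infixl 6 _⊝_
  _⊝_ : Fin n → Fin n → Fin n
  i ⊝ j = i ⊕ ⊖ j

  ⊝-involutive : ∀ c x → c ⊝ (c ⊝ x) ≡ x
  ⊝-involutive c x = trans (cong (c ⊕_) (⊖-⊝ c x)) (trans (sym (⊕-assoc c x (⊖ c))) (⊕-⊝-cancel c x))

  ⊝-⊕ : ∀ c b y → c ⊝ (b ⊕ y) ≡ c ⊝ b ⊝ y
  ⊝-⊕ c b y = trans (cong (c ⊕_) (sym (⊖-⊕-comm b y))) (sym (⊕-assoc c (⊖ b) (⊖ y)))

  ⊝-⊝ : ∀ c b y → c ⊝ (b ⊝ y) ≡ c ⊝ b ⊕ y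
  ⊝-⊝ c b y = begin
    c ⊕ ⊖ (b ⊕ ⊖ y)     ≡⟨ cong (c ⊕_) (⊖-⊕-comm b (⊖ y)) ⟨
    c ⊕ (⊖ b ⊕ ⊖ (⊖ y)) ≡⟨ cong (λ v → c ⊕ (⊖ b ⊕ v)) (⊖-involutive y) ⟩
    c ⊕ (⊖ b ⊕ y)       ≡⟨ ⊕-assoc c (⊖ b) y ⟨
    c ⊝ b ⊕ y           ∎
    where open ≡-Reasoning

  1̂ : Fin n
  1̂ = fin 1

  next-⊕ : ∀ i → next i ≡ i ⊕ 1̂
  next-⊕ i = trans (cong fin (+-comm 1 (toℕ i))) (sym (fin-+ʳ (toℕ i) 1))

  next-injective : ∀ {i j} → next i ≡ next j → i ≡ j
  next-injective {i} {j} e = ⊕-cancelʳ 1̂ i j (trans (sym (next-⊕ i)) (trans e (next-⊕ j)))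

  ⊕-next : ∀ a i → a ⊕ next i ≡ next (a ⊕ i)
  ⊕-next a i = begin
    a ⊕ next i   ≡⟨ cong (a ⊕_) (next-⊕ i) ⟩
    a ⊕ (i ⊕ 1̂)  ≡⟨ ⊕-assoc a i 1̂ ⟨
    a ⊕ i ⊕ 1̂    ≡⟨ next-⊕ (a ⊕ i) ⟨
    next (a ⊕ i) ∎
    where open ≡-Reasoning

  ⊕1-⊝ : ∀ a i → a ⊕ 1̂ ⊝ i ≡ next (a ⊝ i)
  ⊕1-⊝ a i = trans (⊕-⊝-comm a 1̂ (⊖ i)) (sym (next-⊕ (a ⊝ i)))

  ⊕1-⊝-next : ∀ a i → a ⊕ 1̂ ⊝ next i ≡ a ⊝ i
  ⊕1-⊝-next a i = begin
    a ⊕ 1̂ ⊝ next i     ≡⟨ cong (λ v → a ⊕ 1̂ ⊝ v) (trans (next-⊕ i) (⊕-comm i 1̂)) ⟩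
    a ⊕ 1̂ ⊝ (1̂ ⊕ i)    ≡⟨ ⊝-⊕ (a ⊕ 1̂) 1̂ i ⟩
    a ⊕ 1̂ ⊝ 1̂ ⊝ i      ≡⟨ cong (_⊝ i) (⊕-⊝-cancelʳ 1̂ a) ⟩
    a ⊝ i              ∎
    where open ≡-Reasoning

  prev : Fin n → Fin n
  prev i = i ⊝ 1̂

  next-prev : ∀ i → next (prev i) ≡ i
  next-prev i = trans (next-⊕ (prev i)) (⊝-⊕-cancel 1̂ i)

  next^ : ℕ → Fin n → Fin n
  next^ ℕ.zero    i = i
  next^ (ℕ.suc t) i = next (next^ t i)

  next^-fin : ∀ t i → next^ t i ≡ fin (t + toℕ i)
  next^-fin ℕ.zero    i = sym (fin-toℕ i)
  next^-fin (ℕ.suc t) i = trans (cong next (next^-fin t i)) (fin-+ʳ 1 (t + toℕ i))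

  next^-zero : ∀ i → next^ (toℕ i) zero ≡ i
  next^-zero i = trans (next^-fin (toℕ i) zero) (trans (cong fin (+-identityʳ (toℕ i))) (fin-toℕ i))

  next^-reaches : ∀ p q → next^ (toℕ (q ⊝ p)) p ≡ q
  next^-reaches p q = trans (next^-fin (toℕ (q ⊝ p)) p) (⊝-⊕-cancel p q)

  next^-≢ : ∀ t i → 0 < t → t < n → next^ t i ≢ i
  next^-≢ t i 0<t t<n e = <⇒≢ 0<t (sym t≡0)
    where
    fin-t≡zero : fin t ≡ zero
    fin-t≡zero = ⊕-cancelʳ i (fin t) zero (begin
      fin t ⊕ i            ≡⟨ fin-+ˡ t (toℕ i) ⟩
      fin (t + toℕ i)      ≡⟨ next^-fin t i ⟨
      next^ t i            ≡⟨ e ⟩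
      i                    ≡⟨ ⊕-identityˡ i ⟨
      zero ⊕ i             ∎)
      where open ≡-Reasoning
    t≡0 : t ≡ 0
    t≡0 = trans (sym (m<n⇒m%n≡m t<n)) (trans (sym (toℕ-fin t)) (cong toℕ fin-t≡zero))

module Symmetric (n : ℕ) where

  -- A record around the pointwise equality, so that the two permutations can be inferred from a proof.
  infix 4 _≃_
  record _≃_ (σ τ : Perm n) : Set where
    constructor pointwise
    field at : σ ≈ₚ τ
  open _≃_ public

  infix 30 _⁻¹
  _⁻¹ : Perm n → Perm n
  _⁻¹ = P.flip

  infixr 9 _⟨$⟩_
  _⟨$⟩_ : Perm n → Fin n → Fin n
  σ ⟨$⟩ i = σ ⟨$⟩ʳ i

  Sₙ : Group _ _
  Sₙ = record
    { _≈_ = _≃_ ; _∙_ = _·_ ; ε = P.id ; _⁻¹ = _⁻¹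
    ; isGroup = record
      { isMonoid = record
        { isSemigroup = record
          { isMagma = record
            { isEquivalence = record
              { refl = pointwise λ _ → refl
              ; sym = λ e → pointwise λ i → sym (at e i)
              ; trans = λ e f → pointwise λ i → trans (at e i) (at f i) }
            ; ∙-cong = λ {σ} {σ′} {τ} {τ′} e f →
                pointwise λ i → trans (cong (σ ⟨$⟩_) (at f i)) (at e (τ′ ⟨$⟩ i)) }
          ; assoc = λ _ _ _ → pointwise λ _ → refl }
        ; identity = (λ _ → pointwise λ _ → refl) , (λ _ → pointwise λ _ → refl) }
      ; inverse = (λ σ → pointwise λ _ → inverseˡ σ) , (λ σ → pointwise λ _ → inverseʳ σ)
      ; ⁻¹-cong = λ {σ} {τ} e → pointwise λ i →
          trans (sym (inverseˡ τ)) (cong (τ ⁻¹ ⟨$⟩_) (trans (sym (at e _)) (inverseʳ σ))) } }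

  open Group Sₙ public using (⁻¹-cong)
    renaming (refl to ≃-refl; sym to ≃-sym; trans to ≃-trans; reflexive to ≃-reflexive; setoid to ≃-setoid;
              ∙-cong to ·-cong; assoc to ·-assoc; identityˡ to ·-identityˡ; identityʳ to ·-identityʳ)
  open GroupProperties Sₙ public
    using (inverseˡ-unique; ⁻¹-injective; ⁻¹-involutive)
    renaming (∙-cancelˡ to ·-cancelˡ; ∙-cancelʳ to ·-cancelʳ; ⁻¹-anti-homo-∙ to ⁻¹-anti-homo-·)
  module ≃-Reasoning = SetoidReasoning ≃-setoid

  ·-congˡ : ∀ σ {τ τ′} → τ ≃ τ′ → σ · τ ≃ σ · τ′
  ·-congˡ σ = ·-cong (≃-refl {σ})

  ·-congʳ : ∀ {σ σ′} τ → σ ≃ σ′ → σ · τ ≃ σ′ · τ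
  ·-congʳ τ e = ·-cong e (≃-refl {τ})

  transpose-applyˡ : ∀ p q → transpose p q ⟨$⟩ p ≡ q
  transpose-applyˡ p q with p ≟ p
  ... | yes _  = refl
  ... | no p≢p = ⊥-elim (p≢p refl)

  transpose-applyʳ : ∀ p q → transpose p q ⟨$⟩ q ≡ p
  transpose-applyʳ p q with q ≟ p
  ... | yes q≡p = q≡p
  ... | no _ with q ≟ q
  ...   | yes _  = refl
  ...   | no q≢q = ⊥-elim (q≢q refl)

  transpose-applyᵒ : ∀ p q x → x ≢ p → x ≢ q → transpose p q ⟨$⟩ x ≡ x
  transpose-applyᵒ p q x x≢p x≢q with x ≟ p
  ... | yes x≡p = ⊥-elim (x≢p x≡p)
  ... | no _ with x ≟ q
  ...   | yes x≡q = ⊥-elim (x≢q x≡q)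
  ...   | no _    = refl

  transpose-comm : ∀ p q x → transpose p q ⟨$⟩ x ≡ transpose q p ⟨$⟩ x
  transpose-comm p q x = h (x ≟ p) (x ≟ q)
    where
    h : Dec (x ≡ p) → Dec (x ≡ q) → transpose p q ⟨$⟩ x ≡ transpose q p ⟨$⟩ x
    h (yes refl) (yes refl) = refl
    h (yes refl) (no x≢q)   = trans (transpose-applyˡ x q) (sym (transpose-applyʳ q x))
    h (no x≢p)   (yes refl) = trans (transpose-applyʳ p x) (sym (transpose-applyˡ x p))
    h (no x≢p)   (no x≢q)   = trans (transpose-applyᵒ p q x x≢p x≢q) (sym (transpose-applyᵒ q p x x≢q x≢p))

  transpose-self : ∀ p → transpose p p ≃ P.id
  transpose-self p = pointwise λ x → h x (x ≟ p)
    where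
    h : ∀ x → Dec (x ≡ p) → transpose p p ⟨$⟩ x ≡ x
    h x (yes refl) = transpose-applyˡ x x
    h x (no x≢p)   = transpose-applyᵒ p p x x≢p x≢p

  transpose-conj : ∀ σ p q → σ · (transpose p q · σ ⁻¹) ≃ transpose (σ ⟨$⟩ p) (σ ⟨$⟩ q)
  transpose-conj σ p q = pointwise λ y → h y (σ ⁻¹ ⟨$⟩ y ≟ p) (σ ⁻¹ ⟨$⟩ y ≟ q)
    where
    τ : Perm n
    τ = transpose (σ ⟨$⟩ p) (σ ⟨$⟩ q)
    y≡σ : ∀ {y x} → σ ⁻¹ ⟨$⟩ y ≡ x → y ≡ σ ⟨$⟩ x
    y≡σ e = trans (sym (inverseʳ σ)) (cong (σ ⟨$⟩_) e)
    h : ∀ y → Dec (σ ⁻¹ ⟨$⟩ y ≡ p) → Dec (σ ⁻¹ ⟨$⟩ y ≡ q) →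
        σ ⟨$⟩ (transpose p q ⟨$⟩ (σ ⁻¹ ⟨$⟩ y)) ≡ τ ⟨$⟩ y
    h y (yes e) _ = begin
      σ ⟨$⟩ (transpose p q ⟨$⟩ (σ ⁻¹ ⟨$⟩ y)) ≡⟨ cong (λ x → σ ⟨$⟩ (transpose p q ⟨$⟩ x)) e ⟩
      σ ⟨$⟩ (transpose p q ⟨$⟩ p)          ≡⟨ cong (σ ⟨$⟩_) (transpose-applyˡ p q) ⟩
      σ ⟨$⟩ q                               ≡⟨ transpose-applyˡ (σ ⟨$⟩ p) (σ ⟨$⟩ q) ⟨
      τ ⟨$⟩ (σ ⟨$⟩ p)                      ≡⟨ cong (τ ⟨$⟩_) (y≡σ e) ⟨
      τ ⟨$⟩ y                               ∎
      where open ≡-Reasoning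
    h y (no _) (yes e) = begin
      σ ⟨$⟩ (transpose p q ⟨$⟩ (σ ⁻¹ ⟨$⟩ y)) ≡⟨ cong (λ x → σ ⟨$⟩ (transpose p q ⟨$⟩ x)) e ⟩
      σ ⟨$⟩ (transpose p q ⟨$⟩ q)          ≡⟨ cong (σ ⟨$⟩_) (transpose-applyʳ p q) ⟩
      σ ⟨$⟩ p                               ≡⟨ transpose-applyʳ (σ ⟨$⟩ p) (σ ⟨$⟩ q) ⟨
      τ ⟨$⟩ (σ ⟨$⟩ q)                      ≡⟨ cong (τ ⟨$⟩_) (y≡σ e) ⟨
      τ ⟨$⟩ y                               ∎
      where open ≡-Reasoning
    h y (no ≢p) (no ≢q) = trans (cong (σ ⟨$⟩_) (transpose-applyᵒ p q (σ ⁻¹ ⟨$⟩ y) ≢p ≢q))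
      (trans (inverseʳ σ) (sym (transpose-applyᵒ (σ ⟨$⟩ p) (σ ⟨$⟩ q) y (λ e → ≢p (σ⁻¹-of e)) (λ e → ≢q (σ⁻¹-of e)))))
      where
      σ⁻¹-of : ∀ {x} → y ≡ σ ⟨$⟩ x → σ ⁻¹ ⟨$⟩ y ≡ x
      σ⁻¹-of e = trans (cong (σ ⁻¹ ⟨$⟩_) e) (inverseˡ σ)

module Generators (m : ℕ) where
  open Cyclic m public
  open Symmetric n public

  t : Fin n → Fin n → Fin n
  t i y = gen i ⟨$⟩ y

  t-self : ∀ i → t i i ≡ next i
  t-self i = transpose-applyˡ i (next i)

  t-next : ∀ i → t i (next i) ≡ i
  t-next i = transpose-applyʳ i (next i)

  t-other : ∀ i y → y ≢ i → y ≢ next i → t i y ≡ y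
  t-other i = transpose-applyᵒ i (next i)

  gen⁻¹ : ∀ i → gen i ⁻¹ ≃ gen i
  gen⁻¹ i = pointwise (transpose-comm (next i) i)

  t-involutive : ∀ i y → t i (t i y) ≡ y
  t-involutive i y = trans (cong (t i) (sym (at (gen⁻¹ i) y))) (inverseʳ (gen i))

  gen-square : ∀ i → gen i · gen i ≃ P.id
  gen-square i = pointwise (t-involutive i)

  gen-involutive : ∀ i x → gen i · (gen i · x) ≃ x
  gen-involutive i x = pointwise λ y → t-involutive i (x ⟨$⟩ y)

  -- The edges {a, a+1} and {b, b+1} of the n-cycle are disjoint.
  Apart : Fin n → Fin n → Set
  Apart a b = a ≢ b × b ≢ next a × a ≢ next b

  Apart-sym : ∀ {a b} → Apart a b → Apart b a
  Apart-sym (a≢b , b≢a⁺ , a≢b⁺) = (λ e → a≢b (sym e)) , a≢b⁺ , b≢a⁺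

  t-comm : ∀ {a b} → Apart a b → ∀ y → t a (t b y) ≡ t b (t a y)
  t-comm {a} {b} (a≢b , b≢a⁺ , a≢b⁺) y = h (y ≟ a) (y ≟ next a) (y ≟ b) (y ≟ next b)
    where
    a⁺≢b : next a ≢ b
    a⁺≢b e = b≢a⁺ (sym e)
    a⁺≢b⁺ : next a ≢ next b
    a⁺≢b⁺ e = a≢b (next-injective e)
    h : Dec (y ≡ a) → Dec (y ≡ next a) → Dec (y ≡ b) → Dec (y ≡ next b) → t a (t b y) ≡ t b (t a y)
    h (yes refl) _ _ _ = begin
      t a (t b a) ≡⟨ cong (t a) (t-other b a a≢b a≢b⁺) ⟩
      t a a       ≡⟨ t-self a ⟩
      next a      ≡⟨ t-other b (next a) a⁺≢b a⁺≢b⁺ ⟨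
      t b (next a) ≡⟨ cong (t b) (t-self a) ⟨
      t b (t a a) ∎
      where open ≡-Reasoning
    h (no _) (yes refl) _ _ = begin
      t a (t b (next a)) ≡⟨ cong (t a) (t-other b (next a) a⁺≢b a⁺≢b⁺) ⟩
      t a (next a)       ≡⟨ t-next a ⟩
      a                  ≡⟨ t-other b a a≢b a≢b⁺ ⟨
      t b a              ≡⟨ cong (t b) (t-next a) ⟨
      t b (t a (next a)) ∎
      where open ≡-Reasoning
    h (no y≢a) (no y≢a⁺) (yes refl) _ = begin
      t a (t y y)  ≡⟨ cong (t a) (t-self y) ⟩
      t a (next y) ≡⟨ t-other a (next y) (λ e → a≢b⁺ (sym e)) (λ e → a≢b (sym (next-injective e))) ⟩
      next y       ≡⟨ t-self y ⟨
      t y y        ≡⟨ cong (t y) (t-other a y y≢a y≢a⁺) ⟨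
      t y (t a y)  ∎
      where open ≡-Reasoning
    h (no y≢a) (no y≢a⁺) (no _) (yes refl) = begin
      t a (t b (next b)) ≡⟨ cong (t a) (t-next b) ⟩
      t a b              ≡⟨ t-other a b (λ e → a≢b (sym e)) b≢a⁺ ⟩
      b                  ≡⟨ t-next b ⟨
      t b (next b)       ≡⟨ cong (t b) (t-other a (next b) y≢a y≢a⁺) ⟨
      t b (t a (next b)) ∎
      where open ≡-Reasoning
    h (no y≢a) (no y≢a⁺) (no y≢b) (no y≢b⁺) =
      trans (cong (t a) (t-other b y y≢b y≢b⁺))
        (trans (t-other a y y≢a y≢a⁺) (sym (trans (cong (t b) (t-other a y y≢a y≢a⁺)) (t-other b y y≢b y≢b⁺))))

  data Position (j k : Fin n) : Set where
    same   : k ≡ j → Position j k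
    after  : k ≡ next j → Position j k
    before : j ≡ next k → Position j k
    apart  : Apart j k → Position j k

  position : ∀ j k → Position j k
  position j k with k ≟ j | k ≟ next j | j ≟ next k
  ... | yes k≡j | _         | _         = same k≡j
  ... | no _    | yes k≡j⁺  | _         = after k≡j⁺
  ... | no _    | no _      | yes j≡k⁺  = before j≡k⁺
  ... | no k≢j  | no k≢j⁺   | no j≢k⁺   = apart ((λ e → k≢j (sym e)) , k≢j⁺ , j≢k⁺)

  gen-comm : ∀ {a b} → Apart a b → ∀ x → gen a · (gen b · x) ≃ gen b · (gen a · x)
  gen-comm ab x = pointwise λ y → t-comm ab (x ⟨$⟩ y)

  gens : List (Fin n) → Perm n
  gens []      = P.id
  gens (i ∷ w) = gen i · gens w

  gens-++ : ∀ v w → gens (v ++ w) ≃ gens v · gens w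
  gens-++ []      w = ≃-refl
  gens-++ (i ∷ v) w = ·-congˡ (gen i) (gens-++ v w)

  -- (p, q+1) = t q · (p, q) · t q when p ∉ {q, q+1}.
  transpose-next^-word : ∀ d p → ℕ.suc d < n → ∃ λ w → gens w ≃ transpose p (next^ (ℕ.suc d) p)
  transpose-next^-word ℕ.zero    p _   = p ∷ [] , ≃-refl
  transpose-next^-word (ℕ.suc d) p d<n with transpose-next^-word d p (<-trans (n<1+n (ℕ.suc d)) d<n)
  ... | w , gens-w = q ∷ w ++ q ∷ [] , (begin
      gens (q ∷ w ++ q ∷ [])                        ≈⟨ ·-congˡ (gen q) (gens-++ w (q ∷ [])) ⟩
      gen q · (gens w · (gen q · P.id))             ≈⟨ ·-congˡ (gen q) (·-cong gens-w (·-identityʳ (gen q))) ⟩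
      gen q · (transpose p q · gen q)               ≈⟨ ·-congˡ (gen q) (·-congˡ (transpose p q) (gen⁻¹ q)) ⟨
      gen q · (transpose p q · gen q ⁻¹)            ≈⟨ transpose-conj (gen q) p q ⟩
      transpose (t q p) (t q q)                     ≡⟨ cong₂ transpose (t-other q p p≢q p≢q⁺) (t-self q) ⟩
      transpose p (next q)                          ∎)
    where
    open ≃-Reasoning
    q : Fin n
    q = next^ (ℕ.suc d) p
    p≢q : p ≢ q
    p≢q e = next^-≢ (ℕ.suc d) p (s≤s z≤n) (<-trans (n<1+n (ℕ.suc d)) d<n) (sym e)
    p≢q⁺ : p ≢ next q
    p≢q⁺ e = next^-≢ (ℕ.suc (ℕ.suc d)) p (s≤s z≤n) d<n (sym e)

  transpose-word : ∀ p q → ∃ λ w → gens w ≃ transpose p q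
  transpose-word p q = word (toℕ (q ⊝ p)) (toℕ<n (q ⊝ p)) (next^-reaches p q)
    where
    word : ∀ d → d < n → next^ d p ≡ q → ∃ λ w → gens w ≃ transpose p q
    word ℕ.zero    _   refl = [] , ≃-sym (transpose-self p)
    word (ℕ.suc d) d<n refl = transpose-next^-word d p d<n

  transpositions-word : ∀ (xs : TL.TranspositionList n) → ∃ λ w → gens w ≃ TL.eval xs
  transpositions-word [] = [] , ≃-refl
  transpositions-word ((i , j) ∷ xs) =
    let v , gens-v = transpositions-word xs
        w , gens-w = transpose-word i j
    in v ++ w , ≃-trans (gens-++ v w) (·-cong gens-v gens-w)

  gens-surjective : ∀ σ → ∃ λ w → gens w ≃ σ
  gens-surjective σ = proj₁ word , ≃-trans (proj₂ word) (pointwise (TL.eval-decompose σ))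
    where
    word : ∃ λ w → gens w ≃ TL.eval (TL.decompose σ)
    word = transpositions-word (TL.decompose σ)

  δ : Dih n → Fin n → Fin n
  δ (false , a) i = a ⊕ i
  δ (true  , a) i = a ⊝ i

  δ-zero : ∀ p → δ p zero ≡ proj₂ p
  δ-zero (false , a) = ⊕-identityʳ a
  δ-zero (true  , a) = trans (cong (a ⊕_) ⊖-zero) (⊕-identityʳ a)

  -- The reflection x ↦ a + 1 − x maps the edge {i, i+1} to the edge {a − i, a − i + 1}.
  dihFun : Dih n → Fin n → Fin n
  dihFun (false , a) x = a ⊕ x
  dihFun (true  , a) x = (a ⊕ 1̂) ⊝ x

  dihFun⁻¹ : Dih n → Fin n → Fin n
  dihFun⁻¹ (false , a) x = ⊖ a ⊕ x
  dihFun⁻¹ (true  , a) x = (a ⊕ 1̂) ⊝ x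

  dih : Dih n → Perm n
  dih p = P.permutation (dihFun p) (dihFun⁻¹ p) (inverse p) (inverse′ p)
    where
    inverse : ∀ p x → dihFun p (dihFun⁻¹ p x) ≡ x
    inverse (false , a) = ⊕-⊖-cancel a
    inverse (true  , a) = ⊝-involutive (a ⊕ 1̂)
    inverse′ : ∀ p x → dihFun⁻¹ p (dihFun p x) ≡ x
    inverse′ (false , a) = ⊖-⊕-cancel a
    inverse′ (true  , a) = ⊝-involutive (a ⊕ 1̂)

  dih-edge : ∀ p i → transpose (dih p ⟨$⟩ i) (dih p ⟨$⟩ next i) ≃ gen (δ p i)
  dih-edge (false , a) i = ≃-reflexive (cong (transpose (a ⊕ i)) (⊕-next a i))
  dih-edge (true  , a) i = ≃-trans
    (≃-reflexive (cong₂ transpose (⊕1-⊝ a i) (⊕1-⊝-next a i)))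
    (pointwise (transpose-comm (next (a ⊝ i)) (a ⊝ i)))

  dih-gen : ∀ p i → dih p · gen i ≃ gen (δ p i) · dih p
  dih-gen p i = pointwise λ z → begin
    dih p ⟨$⟩ t i z                                          ≡⟨ cong (λ y → dih p ⟨$⟩ t i y) (inverseˡ (dih p)) ⟨
    dih p ⟨$⟩ t i (dih p ⁻¹ ⟨$⟩ dih p ⟨$⟩ z)                 ≡⟨ at (transpose-conj (dih p) i (next i)) (dih p ⟨$⟩ z) ⟩
    transpose (dih p ⟨$⟩ i) (dih p ⟨$⟩ next i) ⟨$⟩ dih p ⟨$⟩ z ≡⟨ at (dih-edge p i) (dih p ⟨$⟩ z) ⟩
    t (δ p i) (dih p ⟨$⟩ z)                                  ∎
    where open ≡-Reasoning

  dih-hom : ∀ p q → dih (p ⋆ q) ≃ dih p · dih q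
  dih-hom p q = pointwise (hom p q)
    where
    ⋆-reflection : ∀ a b → (toℕ a + (n ∸ toℕ b)) mod n ≡ a ⊝ b
    ⋆-reflection a b = sym (fin-+ʳ (toℕ a) (n ∸ toℕ b))
    hom : ∀ p q x → dihFun (p ⋆ q) x ≡ dihFun p (dihFun q x)
    hom (false , a) (false , b) x = ⊕-assoc a b x
    hom (false , a) (true  , b) x = trans (cong (_⊝ x) (⊕-assoc a b 1̂)) (⊕-assoc a (b ⊕ 1̂) (⊖ x))
    hom (true  , a) (false , b) x = begin
      fin (toℕ a + (n ∸ toℕ b)) ⊕ 1̂ ⊝ x ≡⟨ cong (λ v → v ⊕ 1̂ ⊝ x) (⋆-reflection a b) ⟩
      a ⊝ b ⊕ 1̂ ⊝ x                     ≡⟨ cong (_⊝ x) (⊕-⊝-comm a 1̂ (⊖ b)) ⟨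
      a ⊕ 1̂ ⊝ b ⊝ x                     ≡⟨ ⊝-⊕ (a ⊕ 1̂) b x ⟨
      a ⊕ 1̂ ⊝ (b ⊕ x)                   ∎
      where open ≡-Reasoning
    hom (true  , a) (true  , b) x = begin
      fin (toℕ a + (n ∸ toℕ b)) ⊕ x     ≡⟨ cong (_⊕ x) (⋆-reflection a b) ⟩
      a ⊝ b ⊕ x                         ≡⟨ cong (_⊕ x) (⊕1-⊝-next a b) ⟨
      a ⊕ 1̂ ⊝ next b ⊕ x                ≡⟨ cong (λ v → a ⊕ 1̂ ⊝ v ⊕ x) (next-⊕ b) ⟩
      a ⊕ 1̂ ⊝ (b ⊕ 1̂) ⊕ x              ≡⟨ ⊝-⊝ (a ⊕ 1̂) (b ⊕ 1̂) x ⟨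
      a ⊕ 1̂ ⊝ (b ⊕ 1̂ ⊝ x)              ∎
      where open ≡-Reasoning

  gen⇒Adj : ∀ {x y} i → y ≃ gen i · x → Adj x y
  gen⇒Adj i y≃ = gen i , (i , λ _ → refl) , at y≃

  Adj⇒gen : ∀ {x y} → Adj x y → ∃ λ i → y ≃ gen i · x
  Adj⇒gen {x} {y} (s , (i , s≈gen) , y≈sx) =
    i , ≃-trans (pointwise {y} {s · x} y≈sx) (·-congʳ x (pointwise {s} {gen i} s≈gen))

  aut-cong : ∀ θ {x y} → x ≃ y → fun θ x ≃ fun θ y
  aut-cong θ e = pointwise (fun-cong θ (at e))

  aut-injective : ∀ θ {x y} → fun θ x ≃ fun θ y → x ≃ y
  aut-injective θ {x} {y} e = begin
    x                 ≈⟨ pointwise (inv-fun θ x) ⟨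
    inv θ (fun θ x)   ≈⟨ pointwise (inv-cong θ (at e)) ⟩
    inv θ (fun θ y)   ≈⟨ pointwise (inv-fun θ y) ⟩
    y                 ∎
    where open ≃-Reasoning

  aut-adj : ∀ θ {x y} i → y ≃ gen i · x → ∃ λ m → fun θ y ≃ gen m · fun θ x
  aut-adj θ {x} {y} i e = Adj⇒gen {fun θ x} {fun θ y} (adj-pres θ x y (gen⇒Adj {x} {y} i e))

  aut-adj⁻ : ∀ θ {x y} m → fun θ y ≃ gen m · fun θ x → ∃ λ i → y ≃ gen i · x
  aut-adj⁻ θ {x} {y} m e = Adj⇒gen {x} {y} (adj-refl θ x y (gen⇒Adj {fun θ x} {fun θ y} m e))

  record Normalises (σ : Perm n) : Set where
    field
      index : Perm n
      conj  : ∀ i → σ · gen i ≃ gen (index ⟨$⟩ i) · σ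

  dih-normalises : ∀ p → Normalises (dih p)
  dih-normalises p = record
    { index = P.permutation (δ p) (δ⁻¹ p) (δ-δ⁻¹ p) (δ⁻¹-δ p) ; conj = dih-gen p }
    where
    δ⁻¹ : Dih n → Fin n → Fin n
    δ⁻¹ (false , a) j = ⊖ a ⊕ j
    δ⁻¹ (true  , a) j = a ⊝ j
    δ-δ⁻¹ : ∀ p j → δ p (δ⁻¹ p j) ≡ j
    δ-δ⁻¹ (false , a) = ⊕-⊖-cancel a
    δ-δ⁻¹ (true  , a) = ⊝-involutive a
    δ⁻¹-δ : ∀ p i → δ⁻¹ p (δ p i) ≡ i
    δ⁻¹-δ (false , a) = ⊖-⊕-cancel a
    δ⁻¹-δ (true  , a) = ⊝-involutive a

  Normalises-⁻¹ : ∀ {σ} → Normalises σ → Normalises (σ ⁻¹)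
  Normalises-⁻¹ {σ} N = record { index = index ⁻¹ ; conj = conj⁻¹ }
    where
    open Normalises N
    conj⁻¹ : ∀ j → σ ⁻¹ · gen j ≃ gen (index ⁻¹ ⟨$⟩ j) · σ ⁻¹
    conj⁻¹ j = pointwise λ z → begin
      σ ⁻¹ ⟨$⟩ t j z                                      ≡⟨ cong (λ k → σ ⁻¹ ⟨$⟩ t k z) (inverseʳ index) ⟨
      σ ⁻¹ ⟨$⟩ t (index ⟨$⟩ i) z                           ≡⟨ cong (λ y → σ ⁻¹ ⟨$⟩ t (index ⟨$⟩ i) y) (inverseʳ σ) ⟨
      σ ⁻¹ ⟨$⟩ t (index ⟨$⟩ i) (σ ⟨$⟩ σ ⁻¹ ⟨$⟩ z)          ≡⟨ cong (σ ⁻¹ ⟨$⟩_) (at (conj i) (σ ⁻¹ ⟨$⟩ z)) ⟨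
      σ ⁻¹ ⟨$⟩ σ ⟨$⟩ t i (σ ⁻¹ ⟨$⟩ z)                      ≡⟨ inverseˡ σ ⟩
      t i (σ ⁻¹ ⟨$⟩ z)                                     ∎
      where
      open ≡-Reasoning
      i : Fin n
      i = index ⁻¹ ⟨$⟩ j

  leftMul : ∀ σ → Normalises σ → Aut n
  leftMul σ N = record
    { fun = σ ·_
    ; inv = σ ⁻¹ ·_
    ; fun-cong = λ e z → cong (σ ⟨$⟩_) (e z)
    ; inv-cong = λ e z → cong (σ ⁻¹ ⟨$⟩_) (e z)
    ; fun-inv = λ _ _ → inverseʳ σ
    ; inv-fun = λ _ _ → inverseˡ σ
    ; adj-pres = λ x y xy → let i , y≃ = Adj⇒gen {x} {y} xy in
        gen⇒Adj {σ · x} {σ · y} (index ⟨$⟩ i) (pointwise λ z →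
          trans (cong (σ ⟨$⟩_) (at y≃ z)) (at (conj i) (x ⟨$⟩ z)))
    ; adj-refl = λ x y σxy → let j , σy≃ = Adj⇒gen {σ · x} {σ · y} σxy in
        gen⇒Adj {x} {y} (index ⁻¹ ⟨$⟩ j) (·-cancelˡ σ y (gen (index ⁻¹ ⟨$⟩ j) · x) (pointwise λ z →
          trans (at σy≃ z) (sym (trans (at (conj (index ⁻¹ ⟨$⟩ j)) (x ⟨$⟩ z))
                                       (cong (λ k → t k (σ ⟨$⟩ x ⟨$⟩ z)) (inverseʳ index))))))
    }
    where open Normalises N

  rightMul : Perm n → Aut n
  rightMul c = record
    { fun = _· c
    ; inv = _· c ⁻¹
    ; fun-cong = λ e z → e (c ⟨$⟩ z)
    ; inv-cong = λ e z → e (c ⁻¹ ⟨$⟩ z)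
    ; fun-inv = λ x _ → cong (x ⟨$⟩_) (inverseˡ c)
    ; inv-fun = λ x _ → cong (x ⟨$⟩_) (inverseʳ c)
    ; adj-pres = λ x y xy → let i , y≃ = Adj⇒gen {x} {y} xy in gen⇒Adj {x · c} {y · c} i (·-congʳ c y≃)
    ; adj-refl = λ x y xcyc → let i , yc≃ = Adj⇒gen {x · c} {y · c} xcyc in gen⇒Adj {x} {y} i (·-cancelʳ c y (gen i · x) yc≃)
    }

module BubbleSort (k₀ : ℕ) where
  open Generators (4 + k₀) public

  next¹≢ : ∀ i → next i ≢ i
  next¹≢ i = next^-≢ 1 i (s≤s z≤n) (s≤s (s≤s z≤n))

  next²≢ : ∀ i → next (next i) ≢ i
  next²≢ i = next^-≢ 2 i (s≤s z≤n) (s≤s (s≤s (s≤s z≤n)))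

  next³≢ : ∀ i → next (next (next i)) ≢ i
  next³≢ i = next^-≢ 3 i (s≤s z≤n) (s≤s (s≤s (s≤s (s≤s z≤n))))

  next⁴≢ : ∀ i → next (next (next (next i))) ≢ i
  next⁴≢ i = next^-≢ 4 i (s≤s z≤n) (s≤s (s≤s (s≤s (s≤s (s≤s z≤n)))))

  gen-injective : ∀ {c d} → gen c ≃ gen d → c ≡ d
  gen-injective {c} {d} e with c ≟ d
  ... | yes c≡d = c≡d
  ... | no c≢d with c ≟ next d
  ...   | yes c≡d⁺ = ⊥-elim (next²≢ d (begin
      next (next d) ≡⟨ cong next c≡d⁺ ⟨
      next c        ≡⟨ t-self c ⟨
      t c c         ≡⟨ at e c ⟩
      t d c         ≡⟨ cong (t d) c≡d⁺ ⟩
      t d (next d)  ≡⟨ t-next d ⟩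
      d             ∎))
    where open ≡-Reasoning
  ...   | no c≢d⁺ = ⊥-elim (next¹≢ c (trans (sym (t-self c)) (trans (at e c) (t-other d c c≢d c≢d⁺))))

  adjacent-noncomm : ∀ a → ¬ (gen a · gen (next a) ≃ gen (next a) · gen a)
  adjacent-noncomm a e = next¹≢ (next a) (begin
    next (next a)     ≡⟨ t-self (next a) ⟨
    t (next a) (next a) ≡⟨ cong (t (next a)) (t-self a) ⟨
    t (next a) (t a a) ≡⟨ at e a ⟨
    t a (t (next a) a) ≡⟨ cong (t a) (t-other (next a) a (λ e → next¹≢ a (sym e)) (λ e → next²≢ a (sym e))) ⟩
    t a a             ≡⟨ t-self a ⟩
    next a            ∎)
    where open ≡-Reasoning

  -- In t a · t b = t c · t d with a ∉ {b, c, d}, compare where both sides send the point a.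
  module UnmatchedFactor {a b c d} (E : gen a · gen b ≃ gen c · gen d)
                         (a≢b : a ≢ b) (a≢c : a ≢ c) (a≢d : a ≢ d) where
    open ≡-Reasoning

    E-at : ∀ y → t a (t b y) ≡ t c (t d y)
    E-at = at E

    lhs-a-below : a ≡ next b → t a (t b a) ≡ b
    lhs-a-below refl = begin
      t (next b) (t b (next b)) ≡⟨ cong (t (next b)) (t-next b) ⟩
      t (next b) b              ≡⟨ t-other (next b) b (λ e → next¹≢ b (sym e)) (λ e → next²≢ b (sym e)) ⟩
      b                         ∎

    lhs-a-above : a ≢ next b → t a (t b a) ≡ next a
    lhs-a-above a≢b⁺ = trans (cong (t a) (t-other b a a≢b a≢b⁺)) (t-self a)

    lhs-moves-a : t a (t b a) ≢ a
    lhs-moves-a with a ≟ next b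
    ... | yes a≡b⁺ = λ e → a≢b (sym (trans (sym (lhs-a-below a≡b⁺)) e))
    ... | no a≢b⁺  = λ e → next¹≢ a (trans (sym (lhs-a-above a≢b⁺)) e)

    rhs-fixes-a : a ≢ next c → a ≢ next d → ⊥
    rhs-fixes-a a≢c⁺ a≢d⁺ =
      lhs-moves-a (trans (E-at a) (trans (cong (t c) (t-other d a a≢d a≢d⁺)) (t-other c a a≢c a≢c⁺)))

    lhs-a-via-d : a ≡ next d → t a (t b a) ≡ t c d
    lhs-a-via-d a≡d⁺ = begin
      t a (t b a)        ≡⟨ E-at a ⟩
      t c (t d a)        ≡⟨ cong (λ y → t c (t d y)) a≡d⁺ ⟩
      t c (t d (next d)) ≡⟨ cong (t c) (t-next d) ⟩
      t c d              ∎

    above-d : a ≡ next d → ⊥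
    above-d a≡d⁺ with d ≟ c | d ≟ next c | a ≟ next b
    ... | yes refl | _ | _ = lhs-moves-a (trans (lhs-a-via-d a≡d⁺) (trans (t-self d) (sym a≡d⁺)))
    ... | no _ | yes d≡c⁺ | yes a≡b⁺ = a≢d (begin
      a      ≡⟨ a≡b⁺ ⟩
      next b ≡⟨ cong next (trans (sym (lhs-a-below a≡b⁺)) lhs-a≡c) ⟩
      next c ≡⟨ d≡c⁺ ⟨
      d      ∎)
      where
      lhs-a≡c : t a (t b a) ≡ c
      lhs-a≡c = trans (lhs-a-via-d a≡d⁺) (trans (cong (t c) d≡c⁺) (t-next c))
    ... | no _ | yes d≡c⁺ | no a≢b⁺ = next³≢ c (begin
      next (next (next c)) ≡⟨ cong (λ v → next (next v)) d≡c⁺ ⟨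
      next (next d)        ≡⟨ cong next a≡d⁺ ⟨
      next a               ≡⟨ lhs-a-above a≢b⁺ ⟨
      t a (t b a)          ≡⟨ lhs-a-via-d a≡d⁺ ⟩
      t c d                ≡⟨ trans (cong (t c) d≡c⁺) (t-next c) ⟩
      c                    ∎)
    ... | no d≢c | no d≢c⁺ | yes a≡b⁺ = a≢c (gen-injective (·-cancelʳ (gen b) (gen a) (gen c) E′))
      where
      b≡d : b ≡ d
      b≡d = trans (sym (lhs-a-below a≡b⁺)) (trans (lhs-a-via-d a≡d⁺) (t-other c d d≢c d≢c⁺))
      E′ : gen a · gen b ≃ gen c · gen b
      E′ = ≃-trans E (·-congˡ (gen c) (≃-reflexive (cong gen (sym b≡d))))
    ... | no d≢c | no d≢c⁺ | no a≢b⁺ = next²≢ d (begin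
      next (next d) ≡⟨ cong next a≡d⁺ ⟨
      next a        ≡⟨ lhs-a-above a≢b⁺ ⟨
      t a (t b a)   ≡⟨ lhs-a-via-d a≡d⁺ ⟩
      t c d         ≡⟨ t-other c d d≢c d≢c⁺ ⟩
      d             ∎)

    lhs-a-via-c : a ≡ next c → a ≢ next d → t a (t b a) ≡ c
    lhs-a-via-c a≡c⁺ a≢d⁺ = begin
      t a (t b a)  ≡⟨ E-at a ⟩
      t c (t d a)  ≡⟨ cong (t c) (t-other d a a≢d a≢d⁺) ⟩
      t c a        ≡⟨ cong (t c) a≡c⁺ ⟩
      t c (next c) ≡⟨ t-next c ⟩
      c            ∎

    above-c : a ≡ next c → a ≢ next d → ⊥
    above-c a≡c⁺ a≢d⁺ with a ≟ next b
    ... | no a≢b⁺ = next²≢ c (begin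
      next (next c) ≡⟨ cong next a≡c⁺ ⟨
      next a        ≡⟨ lhs-a-above a≢b⁺ ⟨
      t a (t b a)   ≡⟨ lhs-a-via-c a≡c⁺ a≢d⁺ ⟩
      c             ∎)
    ... | yes a≡b⁺ = rhs-next-a (next a ≟ d)
      where
      b≡c : b ≡ c
      b≡c = trans (sym (lhs-a-below a≡b⁺)) (lhs-a-via-c a≡c⁺ a≢d⁺)
      a⁺≢c : next a ≢ c
      a⁺≢c e = next²≢ b (trans (cong next (sym a≡b⁺)) (trans e (sym b≡c)))
      a⁺≢c⁺ : next a ≢ next c
      a⁺≢c⁺ e = a≢c (next-injective e)
      lhs-next-a : t a (t b (next a)) ≡ a
      lhs-next-a = trans (cong (λ v → t a (t v (next a))) b≡c)
                         (trans (cong (t a) (t-other c (next a) a⁺≢c a⁺≢c⁺)) (t-next a))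
      rhs-next-a : Dec (next a ≡ d) → ⊥
      rhs-next-a (yes a⁺≡d) = next²≢ a (begin
        next (next a)           ≡⟨ t-other c (next (next a)) a⁺⁺≢c a⁺⁺≢c⁺ ⟨
        t c (next (next a))     ≡⟨ cong (λ v → t c (next v)) a⁺≡d ⟩
        t c (next d)            ≡⟨ cong (t c) (t-self d) ⟨
        t c (t d d)             ≡⟨ cong (λ v → t c (t d v)) a⁺≡d ⟨
        t c (t d (next a))      ≡⟨ E-at (next a) ⟨
        t a (t b (next a))      ≡⟨ lhs-next-a ⟩
        a                       ∎)
        where
        a⁺⁺≢c : next (next a) ≢ c
        a⁺⁺≢c e = next³≢ b (trans (cong (λ v → next (next v)) (sym a≡b⁺)) (trans e (sym b≡c)))
        a⁺⁺≢c⁺ : next (next a) ≢ next c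
        a⁺⁺≢c⁺ e = next²≢ a (trans e (sym a≡c⁺))
      rhs-next-a (no a⁺≢d) = next¹≢ a (begin
        next a             ≡⟨ t-other c (next a) a⁺≢c a⁺≢c⁺ ⟨
        t c (next a)       ≡⟨ cong (t c) (t-other d (next a) a⁺≢d (λ e → a≢d (next-injective e))) ⟨
        t c (t d (next a)) ≡⟨ E-at (next a) ⟨
        t a (t b (next a)) ≡⟨ lhs-next-a ⟩
        a                  ∎)

    absurd : ⊥
    absurd with a ≟ next d | a ≟ next c
    ... | yes a≡d⁺ | _        = above-d a≡d⁺
    ... | no a≢d⁺  | yes a≡c⁺ = above-c a≡c⁺ a≢d⁺
    ... | no a≢d⁺  | no a≢c⁺  = rhs-fixes-a a≢c⁺ a≢d⁺

  unmatched-factor : ∀ {a b c d} → gen a · gen b ≃ gen c · gen d → a ≢ b → a ≢ c → a ≢ d → ⊥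
  unmatched-factor E a≢b a≢c a≢d = UnmatchedFactor.absurd E a≢b a≢c a≢d

  data SameProduct (a b c d : Fin n) : Set where
    both-trivial : a ≡ b → c ≡ d → SameProduct a b c d
    same-factors : a ≡ c → b ≡ d → SameProduct a b c d
    commuted     : a ≡ d → b ≡ c → SameProduct a b c d

  gen-product-swap : ∀ {a b c d} → gen a · gen b ≃ gen c · gen d → gen b · gen a ≃ gen d · gen c
  gen-product-swap {a} {b} {c} {d} E = begin
    gen b · gen a         ≈⟨ ·-cong (gen⁻¹ b) (gen⁻¹ a) ⟨
    gen b ⁻¹ · gen a ⁻¹   ≈⟨ ⁻¹-anti-homo-· (gen a) (gen b) ⟨
    (gen a · gen b) ⁻¹    ≈⟨ ⁻¹-cong E ⟩
    (gen c · gen d) ⁻¹    ≈⟨ ⁻¹-anti-homo-· (gen c) (gen d) ⟩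
    gen d ⁻¹ · gen c ⁻¹   ≈⟨ ·-cong (gen⁻¹ d) (gen⁻¹ c) ⟩
    gen d · gen c         ∎
    where open ≃-Reasoning

  gen-product-cases : ∀ {a b c d} → gen a · gen b ≃ gen c · gen d → SameProduct a b c d
  gen-product-cases {a} {b} {c} {d} E with a ≟ b
  ... | yes refl = both-trivial refl (gen-injective (begin
      gen c                 ≈⟨ inverseˡ-unique (gen c) (gen d) (≃-trans (≃-sym E) (gen-square a)) ⟩
      gen d ⁻¹              ≈⟨ gen⁻¹ d ⟩
      gen d                 ∎))
    where open ≃-Reasoning
  ... | no a≢b with a ≟ c
  ...   | yes refl = same-factors refl (gen-injective (·-cancelˡ (gen a) (gen b) (gen d) E))
  ...   | no a≢c with a ≟ d
  ...     | no a≢d = ⊥-elim (unmatched-factor E a≢b a≢c a≢d)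
  ...     | yes refl with b ≟ c
  ...       | yes b≡c = commuted refl b≡c
  ...       | no b≢c  = ⊥-elim (unmatched-factor (gen-product-swap E) b≢a b≢a b≢c)
    where
    b≢a : b ≢ a
    b≢a e = a≢b (sym e)

  Apart-next² : ∀ i → Apart i (next (next i))
  Apart-next² i = (λ e → next²≢ i (sym e)) , next¹≢ (next i) , (λ e → next³≢ i (sym e))

  Apart-next³ : ∀ i → Apart i (next (next (next i)))
  Apart-next³ i = (λ e → next³≢ i (sym e)) , (λ e → next²≢ i (next-injective e)) , (λ e → next⁴≢ i (sym e))

  module Rigidity (θ : Aut n) (fixes-id : fun θ P.id ≃ P.id) (fixes-gens : ∀ i → fun θ (gen i) ≃ gen i) where

    NbhdFixed : Perm n → Set
    NbhdFixed x = fun θ x ≃ x × (∀ i → fun θ (gen i · x) ≃ gen i · x)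

    module Spread {x} (nf : NbhdFixed x) (j : Fin n) where
      y : Perm n
      y = gen j · x

      image : ∀ k → ∃ λ m → fun θ (gen k · y) ≃ gen m · y
      image k = let m , θz≃ = aut-adj θ {y} {gen k · y} k ≃-refl in m , ≃-trans θz≃ (·-congˡ (gen m) (proj₂ nf j))

      not-back : ∀ {k} → fun θ (gen k · y) ≃ gen j · y → k ≡ j
      not-back {k} e = gen-injective (·-cancelʳ y (gen k) (gen j) (begin
        gen k · y             ≈⟨ aut-injective θ (≃-trans e (≃-trans (gen-involutive j x) (≃-sym (proj₁ nf)))) ⟩
        x                     ≈⟨ gen-involutive j x ⟨
        gen j · y             ∎))
        where open ≃-Reasoning

      fixes-apart : ∀ {k} → Apart j k → fun θ (gen k · y) ≃ gen k · y
      fixes-apart {k} jk = square (image k) (aut-adj θ {gen k · x} {gen k · y} j (gen-comm (Apart-sym jk) x))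
        where
        square : (∃ λ m → fun θ (gen k · y) ≃ gen m · y) →
                 (∃ λ r → fun θ (gen k · y) ≃ gen r · fun θ (gen k · x)) → fun θ (gen k · y) ≃ gen k · y
        square (m , θz≃) (r , θz≃′) = cases (gen-product-cases {m} {j} {r} {k} (·-cancelʳ x (gen m · gen j) (gen r · gen k)
          (≃-trans (≃-sym θz≃) (≃-trans θz≃′ (·-congˡ (gen r) (proj₂ nf k))))))
          where
          cases : SameProduct m j r k → fun θ (gen k · y) ≃ gen k · y
          cases (both-trivial refl _) = ⊥-elim (proj₁ jk (sym (not-back θz≃)))
          cases (same-factors _ j≡k)  = ⊥-elim (proj₁ jk j≡k)
          cases (commuted refl _)     = θz≃

      -- θ would map the square t u t k y, t k y, y, t u y onto a 4-cycle through t m y and t u y,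
      -- which by gen-product-cases forces t u and t m to commute.
      no-skew : ∀ {k m u} → Apart j u → Apart k u → m ≢ u → ¬ (gen u · gen m ≃ gen m · gen u) →
                ¬ (fun θ (gen k · y) ≃ gen m · y)
      no-skew {k} {m} {u} ju ku m≢u noncomm θz≃ =
        square (aut-adj θ {gen k · y} {gen u · (gen k · y)} u ≃-refl)
               (aut-adj θ {gen u · y} {gen u · (gen k · y)} k (gen-comm (Apart-sym ku) y))
        where
        square : (∃ λ α → fun θ (gen u · (gen k · y)) ≃ gen α · fun θ (gen k · y)) →
                 (∃ λ β → fun θ (gen u · (gen k · y)) ≃ gen β · fun θ (gen u · y)) → ⊥
        square (α , θv≃) (β , θv≃′) = cases (gen-product-cases {α} {m} {β} {u} E)
          where
          E : gen α · gen m ≃ gen β · gen u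
          E = ·-cancelʳ y (gen α · gen m) (gen β · gen u) (≃-trans (≃-sym (≃-trans θv≃ (·-congˡ (gen α) θz≃)))
                                                                  (≃-trans θv≃′ (·-congˡ (gen β) (fixes-apart ju))))
          cases : SameProduct α m β u → ⊥
          cases (same-factors _ m≡u)  = m≢u m≡u
          cases (commuted refl refl)  = noncomm E
          cases (both-trivial refl _) = proj₁ ku (gen-injective {k} {u} (·-cancelʳ y (gen k) (gen u)
              (·-cancelˡ (gen u) (gen k · y) (gen u · y) (begin
            gen u · (gen k · y)  ≈⟨ aut-injective θ θv≃y ⟩
            y                    ≈⟨ gen-involutive u y ⟨
            gen u · (gen u · y)  ∎))))
            where
            open ≃-Reasoning
            θv≃y : fun θ (gen u · (gen k · y)) ≃ fun θ y
            θv≃y = ≃-trans θv≃ (≃-trans (·-congˡ (gen m) θz≃) (≃-trans (gen-involutive m y) (≃-sym (proj₂ nf j))))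

      retarget : ∀ {k m m′} → m ≡ m′ → fun θ (gen k · y) ≃ gen m · y → fun θ (gen k · y) ≃ gen m′ · y
      retarget refl θz≃ = θz≃

      skew-above : ∀ {k m} → j ≡ next k → m ≡ next j → ¬ (fun θ (gen k · y) ≃ gen m · y)
      skew-above {k} j≡k⁺ refl = no-skew {k} {next j} {next (next j)}
        (Apart-next² j)
        (subst (λ v → Apart k (next (next v))) (sym j≡k⁺) (Apart-next³ k))
        (λ e → next¹≢ (next j) (sym e))
        (λ E → adjacent-noncomm (next j) (≃-sym E))

      skew-below : ∀ {k u} → k ≡ next j → j ≡ next (next u) → ¬ (fun θ (gen k · y) ≃ gen (next u) · y)
      skew-below {u = u} refl j≡u⁺⁺ = no-skew {next j} {next u} {u}
        (subst (λ v → Apart v u) (sym j≡u⁺⁺) (Apart-sym (Apart-next² u)))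
        (subst (λ v → Apart (next v) u) (sym j≡u⁺⁺) (Apart-sym (Apart-next³ u)))
        (next¹≢ u)
        (adjacent-noncomm u)

      fixes-adjacent : ∀ {k} → k ≢ j → k ≡ next j ⊎ j ≡ next k → fun θ (gen k · y) ≃ gen k · y
      fixes-adjacent {k} k≢j adj = from-image (image k)
        where
        from-image : (∃ λ m → fun θ (gen k · y) ≃ gen m · y) → fun θ (gen k · y) ≃ gen k · y
        from-image (m , θz≃) = go (position j m) adj
          where
          go : Position j m → k ≡ next j ⊎ j ≡ next k → fun θ (gen k · y) ≃ gen k · y
          go (same refl) _ = ⊥-elim (k≢j (not-back θz≃))
          go (apart jm)  _ = retarget (sym (gen-injective {k} {m} (·-cancelʳ y (gen k) (gen m)
                               (aut-injective θ (≃-trans θz≃ (≃-sym (fixes-apart jm))))))) θz≃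
          go (after m≡j⁺)  (inj₁ k≡j⁺) = retarget (trans m≡j⁺ (sym k≡j⁺)) θz≃
          go (after m≡j⁺)  (inj₂ j≡k⁺) = ⊥-elim (skew-above j≡k⁺ m≡j⁺ θz≃)
          go (before j≡m⁺) (inj₂ j≡k⁺) = retarget (next-injective (trans (sym j≡m⁺) j≡k⁺)) θz≃
          go (before j≡m⁺) (inj₁ k≡j⁺) = ⊥-elim (skew-below {k} {prev m} k≡j⁺ j≡u⁺⁺ (retarget m≡u⁺ θz≃))
            where
            m≡u⁺ : m ≡ next (prev m)
            m≡u⁺ = sym (next-prev m)
            j≡u⁺⁺ : j ≡ next (next (prev m))
            j≡u⁺⁺ = trans j≡m⁺ (cong next m≡u⁺)

      step : NbhdFixed y
      step = proj₂ nf j , λ k → fixes (position j k)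
        where
        fixes : ∀ {k} → Position j k → fun θ (gen k · y) ≃ gen k · y
        fixes (same refl)   = ≃-trans (aut-cong θ (gen-involutive j x)) (≃-trans (proj₁ nf) (≃-sym (gen-involutive j x)))
        fixes (after k≡j⁺)  = fixes-adjacent (λ e → next¹≢ _ (trans (sym k≡j⁺) e)) (inj₁ k≡j⁺)
        fixes (before j≡k⁺) = fixes-adjacent (λ e → next¹≢ _ (trans (sym j≡k⁺) (sym e))) (inj₂ j≡k⁺)
        fixes (apart jk)    = fixes-apart jk

    NbhdFixed-resp : ∀ {x x′} → x ≃ x′ → NbhdFixed x → NbhdFixed x′
    NbhdFixed-resp e (θx , θgx) =
      ≃-trans (aut-cong θ (≃-sym e)) (≃-trans θx e) ,
      λ i → ≃-trans (aut-cong θ (·-congˡ (gen i) (≃-sym e))) (≃-trans (θgx i) (·-congˡ (gen i) e))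

    NbhdFixed-gens : ∀ w {x} → NbhdFixed x → NbhdFixed (gens w · x)
    NbhdFixed-gens []      {x} nf = NbhdFixed-resp (≃-sym (·-identityˡ x)) nf
    NbhdFixed-gens (i ∷ w) {x} nf =
      NbhdFixed-resp (≃-sym (·-assoc (gen i) (gens w) x)) (Spread.step (NbhdFixed-gens w nf) i)

    NbhdFixed-id : NbhdFixed P.id
    NbhdFixed-id = fixes-id , λ i →
      ≃-trans (aut-cong θ (·-identityʳ (gen i))) (≃-trans (fixes-gens i) (≃-sym (·-identityʳ (gen i))))

    rigid : ∀ x → fun θ x ≃ x
    rigid x = proj₁ (NbhdFixed-resp {gens w · P.id} {x} (≃-trans (·-identityʳ (gens w)) gens-w)
                                    (NbhdFixed-gens w NbhdFixed-id))
      where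
      w : List (Fin n)
      w = proj₁ (gens-surjective x)
      gens-w : gens w ≃ x
      gens-w = proj₂ (gens-surjective x)

  CycleStep : Bool → Fin n → Fin n → Set
  CycleStep false x y = y ≡ next x
  CycleStep true  x y = next y ≡ x

  CycleStep-deterministic : ∀ e {x y y′} → CycleStep e x y → CycleStep e x y′ → y ≡ y′
  CycleStep-deterministic false y≡x⁺ y′≡x⁺ = trans y≡x⁺ (sym y′≡x⁺)
  CycleStep-deterministic true  y⁺≡x y′⁺≡x = next-injective (trans y⁺≡x (sym y′⁺≡x))

  CycleStep-flip : ∀ e {x y} → CycleStep e x y → CycleStep (not e) y x
  CycleStep-flip false y≡x⁺ = sym y≡x⁺
  CycleStep-flip true  y⁺≡x = sym y⁺≡x

  δ-step : ∀ p i → CycleStep (proj₁ p) (δ p i) (δ p (next i))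
  δ-step (false , a) i = ⊕-next a i
  δ-step (true  , a) i = trans (sym (⊕1-⊝ a (next i))) (⊕1-⊝-next a i)

  δ-continuation : ∀ p e {x z} → CycleStep e (δ p (next x)) z → z ≡ δ p (next (next x)) ⊎ z ≡ δ p x
  δ-continuation p@(false , _) false {x} s =
    inj₁ (CycleStep-deterministic false {δ p (next x)} s (δ-step p (next x)))
  δ-continuation p@(false , _) true  {x} s =
    inj₂ (CycleStep-deterministic true {δ p (next x)} s (CycleStep-flip false {δ p x} {δ p (next x)} (δ-step p x)))
  δ-continuation p@(true  , _) false {x} s =
    inj₂ (CycleStep-deterministic false {δ p (next x)} s (CycleStep-flip true {δ p x} {δ p (next x)} (δ-step p x)))
  δ-continuation p@(true  , _) true  {x} s =
    inj₁ (CycleStep-deterministic true {δ p (next x)} s (δ-step p (next x)))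

  CycleStep-opposite : ∀ {x y} → CycleStep false x y → CycleStep true x y → ⊥
  CycleStep-opposite {x} y≡x⁺ y⁺≡x = next²≢ x (trans (cong next (sym y≡x⁺)) y⁺≡x)

  δ-injective : ∀ {p q} → (∀ i → δ p i ≡ δ q i) → p ≡ q
  δ-injective {e , a} {e′ , b} δ≗δ = cong₂ _,_ (orientation e e′ s s′) a≡b
    where
    a≡b : a ≡ b
    a≡b = trans (sym (δ-zero (e , a))) (trans (δ≗δ zero) (δ-zero (e′ , b)))
    y : Fin n
    y = δ (e , a) (next zero)
    s : CycleStep e a y
    s = subst (λ v → CycleStep e v y) (δ-zero (e , a)) (δ-step (e , a) zero)
    s′ : CycleStep e′ a y
    s′ = subst₂ (CycleStep e′) (trans (δ-zero (e′ , b)) (sym a≡b)) (sym (δ≗δ (next zero))) (δ-step (e′ , b) zero)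
    orientation : ∀ e e′ → CycleStep e a y → CycleStep e′ a y → e ≡ e′
    orientation false false _ _  = refl
    orientation true  true  _ _  = refl
    orientation false true  s s′ = ⊥-elim (CycleStep-opposite s s′)
    orientation true  false s s′ = ⊥-elim (CycleStep-opposite s′ s)

  cycle-map-dihedral : ∀ (f : Fin n → Fin n) → (∀ {i j} → f i ≡ f j → i ≡ j) →
                       (∀ i → ∃ λ e → CycleStep e (f i) (f (next i))) → ∃ λ p → ∀ i → f i ≡ δ p i
  cycle-map-dihedral f f-injective f-step =
    p , λ i → subst (λ v → f v ≡ δ p v) (next^-zero i) (proj₁ (agree (toℕ i)))
    where
    p : Dih n
    p = proj₁ (f-step zero) , f zero
    agree : ∀ t → f (next^ t zero) ≡ δ p (next^ t zero) × f (next^ (ℕ.suc t) zero) ≡ δ p (next^ (ℕ.suc t) zero)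
    agree ℕ.zero = sym (δ-zero p) ,
      CycleStep-deterministic (proj₁ p) {f zero} (proj₂ (f-step zero))
        (subst (λ v → CycleStep (proj₁ p) v (δ p (next zero))) (δ-zero p) (δ-step p zero))
    agree (ℕ.suc t) with agree t | f-step (next (next^ t zero))
    ... | f≡δ , f⁺≡δ⁺ | e , s = f⁺≡δ⁺ , continue (δ-continuation p e (subst (λ v → CycleStep e v _) f⁺≡δ⁺ s))
      where
      x : Fin n
      x = next^ t zero
      continue : f (next (next x)) ≡ δ p (next (next x)) ⊎ f (next (next x)) ≡ δ p x →
                 f (next (next x)) ≡ δ p (next (next x))
      continue (inj₁ f⁺⁺≡δ⁺⁺) = f⁺⁺≡δ⁺⁺
      continue (inj₂ f⁺⁺≡δ)   = ⊥-elim (next²≢ x (f-injective (trans f⁺⁺≡δ (sym f≡δ))))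

  module Decomposition (φ : Aut n) {f : Fin n → Fin n} (f-spec : ∀ i → fun φ (gen i) ≃ gen (f i) · fun φ P.id) where
    h : Perm n
    h = fun φ P.id

    f-injective : ∀ {i j} → f i ≡ f j → i ≡ j
    f-injective {i} {j} fi≡fj = gen-injective (aut-injective φ (begin
      fun φ (gen i)  ≈⟨ f-spec i ⟩
      gen (f i) · h  ≡⟨ cong (λ m → gen m · h) fi≡fj ⟩
      gen (f j) · h  ≈⟨ f-spec j ⟨
      fun φ (gen j)  ∎))
      where open ≃-Reasoning

    -- Otherwise t (f i) t (f (i+1)) h closes a 4-cycle with φ (t i), h and φ (t (i+1)); pulled back
    -- along φ, it would make t i and t (i+1) commute.
    f-not-apart : ∀ i → ¬ Apart (f i) (f (next i))
    f-not-apart i ab = square w-adj-next w-adj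
      where
      v : Perm n
      v = gen (f i) · (gen (f (next i)) · h)
      w : Perm n
      w = inv φ v
      φw : fun φ w ≃ v
      φw = pointwise (fun-inv φ v)
      w-adj-next : ∃ λ α → w ≃ gen α · gen (next i)
      w-adj-next = aut-adj⁻ φ {gen (next i)} {w} (f i)
        (≃-trans φw (·-congˡ (gen (f i)) (≃-sym (f-spec (next i)))))
      w-adj : ∃ λ β → w ≃ gen β · gen i
      w-adj = aut-adj⁻ φ {gen i} {w} (f (next i))
        (≃-trans φw (≃-trans (gen-comm ab h) (·-congˡ (gen (f (next i))) (≃-sym (f-spec i)))))
      square : (∃ λ α → w ≃ gen α · gen (next i)) → (∃ λ β → w ≃ gen β · gen i) → ⊥
      square (α , w≃) (β , w≃′) = cases (gen-product-cases {α} {next i} {β} {i} E)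
        where
        E : gen α · gen (next i) ≃ gen β · gen i
        E = ≃-trans (≃-sym w≃) w≃′
        cases : SameProduct α (next i) β i → ⊥
        cases (same-factors _ i⁺≡i) = next¹≢ i i⁺≡i
        cases (commuted refl refl)  = adjacent-noncomm i E
        cases (both-trivial refl _) =
          proj₁ ab (sym (gen-injective {f (next i)} {f i} (·-cancelʳ h (gen (f (next i))) (gen (f i))
            (·-cancelˡ (gen (f i)) (gen (f (next i)) · h) (gen (f i) · h) (begin
              v                           ≈⟨ φw ⟨
              fun φ w                     ≈⟨ aut-cong φ (≃-trans w≃ (gen-square (next i))) ⟩
              h                           ≈⟨ gen-involutive (f i) h ⟨
              gen (f i) · (gen (f i) · h) ∎)))))
          where open ≃-Reasoning

    f-step : ∀ i → ∃ λ e → CycleStep e (f i) (f (next i))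
    f-step i with position (f i) (f (next i))
    ... | same fi⁺≡fi    = ⊥-elim (next¹≢ i (f-injective fi⁺≡fi))
    ... | after fi⁺≡fi⁺  = false , fi⁺≡fi⁺
    ... | before fi≡fi⁺⁺ = true , sym fi≡fi⁺⁺
    ... | apart ab       = ⊥-elim (f-not-apart i ab)

    p : Dih n
    p = proj₁ (cycle-map-dihedral f f-injective f-step)

    f≗δ : ∀ i → f i ≡ δ p i
    f≗δ = proj₂ (cycle-map-dihedral f f-injective f-step)

    c : Perm n
    c = dih p ⁻¹ · h

    θ : Aut n
    θ = leftMul (dih p ⁻¹) (Normalises-⁻¹ (dih-normalises p)) ∘ᴬ (rightMul (h ⁻¹ · dih p) ∘ᴬ φ)

    θ-id : fun θ P.id ≃ P.id
    θ-id = pointwise λ z → trans (cong (dih p ⁻¹ ⟨$⟩_) (inverseʳ h)) (inverseˡ (dih p))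

    θ-gen : ∀ i → fun θ (gen i) ≃ gen i
    θ-gen i = pointwise λ z → begin
      dih p ⁻¹ ⟨$⟩ fun φ (gen i) ⟨$⟩ h ⁻¹ ⟨$⟩ dih p ⟨$⟩ z     ≡⟨ cong (dih p ⁻¹ ⟨$⟩_) (at (f-spec i) _) ⟩
      dih p ⁻¹ ⟨$⟩ t (f i) (h ⟨$⟩ h ⁻¹ ⟨$⟩ dih p ⟨$⟩ z)       ≡⟨ cong (λ y → dih p ⁻¹ ⟨$⟩ t (f i) y) (inverseʳ h) ⟩
      dih p ⁻¹ ⟨$⟩ t (f i) (dih p ⟨$⟩ z)                      ≡⟨ cong (λ m → dih p ⁻¹ ⟨$⟩ t m (dih p ⟨$⟩ z)) (f≗δ i) ⟩
      dih p ⁻¹ ⟨$⟩ t (δ p i) (dih p ⟨$⟩ z)                    ≡⟨ cong (dih p ⁻¹ ⟨$⟩_) (at (dih-gen p i) z) ⟨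
      dih p ⁻¹ ⟨$⟩ dih p ⟨$⟩ t i z                            ≡⟨ inverseˡ (dih p) ⟩
      t i z                                                   ∎
      where open ≡-Reasoning

    open Rigidity θ θ-id θ-gen using (rigid)

    characterisation : ∀ x → fun φ x ≃ dih p · (x · c)
    characterisation x = pointwise λ z → begin
      fun φ x ⟨$⟩ z                                              ≡⟨ inverseʳ (dih p) ⟨
      dih p ⟨$⟩ dih p ⁻¹ ⟨$⟩ fun φ x ⟨$⟩ z                       ≡⟨ cong (λ y → dih p ⟨$⟩ dih p ⁻¹ ⟨$⟩ fun φ x ⟨$⟩ y) (h-cancel z) ⟨
      dih p ⟨$⟩ fun θ x ⟨$⟩ c ⟨$⟩ z                              ≡⟨ cong (dih p ⟨$⟩_) (at (rigid x) (c ⟨$⟩ z)) ⟩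
      dih p ⟨$⟩ x ⟨$⟩ c ⟨$⟩ z                                    ∎
      where
      open ≡-Reasoning
      h-cancel : ∀ z → h ⁻¹ ⟨$⟩ dih p ⟨$⟩ c ⟨$⟩ z ≡ z
      h-cancel z = trans (cong (h ⁻¹ ⟨$⟩_) (inverseʳ (dih p))) (inverseˡ h)

    decomposition-unique : ∀ q c′ → (∀ x → fun φ x ≃ dih q · (x · c′)) → p ≡ q × c ≃ c′
    decomposition-unique q c′ H = p≡q , c≃c′
      where
      h≃ : h ≃ dih q · c′
      h≃ = ≃-trans (H P.id) (·-congˡ (dih q) (·-identityˡ c′))
      f≗δq : ∀ i → f i ≡ δ q i
      f≗δq i = gen-injective {f i} {δ q i} (·-cancelʳ h (gen (f i)) (gen (δ q i)) (begin
        gen (f i) · h               ≈⟨ f-spec i ⟨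
        fun φ (gen i)               ≈⟨ H (gen i) ⟩
        dih q · (gen i · c′)        ≈⟨ pointwise (λ z → at (dih-gen q i) (c′ ⟨$⟩ z)) ⟩
        gen (δ q i) · (dih q · c′)  ≈⟨ ·-congˡ (gen (δ q i)) h≃ ⟨
        gen (δ q i) · h             ∎))
        where open ≃-Reasoning
      p≡q : p ≡ q
      p≡q = δ-injective (λ i → trans (sym (f≗δ i)) (f≗δq i))
      c≃c′ : c ≃ c′
      c≃c′ = pointwise λ z → trans (cong (λ r → dih r ⁻¹ ⟨$⟩ h ⟨$⟩ z) p≡q)
                                   (trans (cong (dih q ⁻¹ ⟨$⟩_) (at h≃ z)) (inverseˡ (dih q)))

  index-map : ∀ φ i → ∃ λ m → fun φ (gen i) ≃ gen m · fun φ P.id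
  index-map φ i = aut-adj φ {P.id} {gen i} i (≃-sym (·-identityʳ (gen i)))

  module Of (φ : Aut n) = Decomposition φ (λ i → proj₂ (index-map φ i))

  -- Right multiplication reverses the order of composition, hence the inverse.
  Φ : Aut n → Perm n × Dih n
  Φ φ = Of.c φ ⁻¹ , Of.p φ

  Φ-hom : ∀ φ ψ → Φ (φ ∘ᴬ ψ) ≈ˣ (Φ φ ⊗ Φ ψ)
  Φ-hom φ ψ = at (≃-trans (⁻¹-cong (proj₂ unique)) (⁻¹-anti-homo-· (Of.c ψ) (Of.c φ))) , proj₁ unique
    where
    composite : ∀ x → fun φ (fun ψ x) ≃ dih (Of.p φ ⋆ Of.p ψ) · (x · (Of.c ψ · Of.c φ))
    composite x = ≃-trans (Of.characterisation φ (fun ψ x))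
      (≃-trans (·-congˡ (dih (Of.p φ)) (·-congʳ (Of.c φ) (Of.characterisation ψ x)))
               (pointwise λ z → sym (at (dih-hom (Of.p φ) (Of.p ψ)) _)))
    unique : Of.p (φ ∘ᴬ ψ) ≡ Of.p φ ⋆ Of.p ψ × Of.c (φ ∘ᴬ ψ) ≃ Of.c ψ · Of.c φ
    unique = Of.decomposition-unique (φ ∘ᴬ ψ) (Of.p φ ⋆ Of.p ψ) (Of.c ψ · Of.c φ) composite

  Φ-cong : ∀ {φ ψ} → φ ≈ᴬ ψ → Φ φ ≈ˣ Φ ψ
  Φ-cong {φ} {ψ} φ≈ψ = at (⁻¹-cong (≃-sym (proj₂ unique))) , sym (proj₁ unique)
    where
    unique : Of.p ψ ≡ Of.p φ × Of.c ψ ≃ Of.c φ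
    unique = Of.decomposition-unique ψ (Of.p φ) (Of.c φ)
               (λ x → ≃-trans (pointwise {fun ψ x} {fun φ x} (λ z → sym (φ≈ψ x z))) (Of.characterisation φ x))

  Φ-injective : ∀ {φ ψ} → Φ φ ≈ˣ Φ ψ → φ ≈ᴬ ψ
  Φ-injective {φ} {ψ} (c⁻¹≈ , p≡) x = at (begin
    fun φ x                      ≈⟨ Of.characterisation φ x ⟩
    dih (Of.p φ) · (x · Of.c φ)  ≈⟨ pointwise (λ z → cong₂ (λ r y → dih r ⟨$⟩ x ⟨$⟩ y) p≡ (at c≃ z)) ⟩
    dih (Of.p ψ) · (x · Of.c ψ)  ≈⟨ Of.characterisation ψ x ⟨
    fun ψ x                      ∎)
    where
    open ≃-Reasoning
    c≃ : Of.c φ ≃ Of.c ψ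
    c≃ = ⁻¹-injective (pointwise {Of.c φ ⁻¹} {Of.c ψ ⁻¹} c⁻¹≈)

  Φ-surjective : ∀ y → ∃ λ φ → Φ φ ≈ˣ y
  Φ-surjective (σ , q) = φ , at (≃-trans (⁻¹-cong (proj₂ unique)) (⁻¹-involutive σ)) , proj₁ unique
    where
    φ : Aut n
    φ = leftMul (dih q) (dih-normalises q) ∘ᴬ rightMul (σ ⁻¹)
    unique : Of.p φ ≡ q × Of.c φ ≃ σ ⁻¹
    unique = Of.decomposition-unique φ q (σ ⁻¹) (λ x → ≃-refl)

  aut-iso : AutIso n
  aut-iso = record
    { Φ      = Φ
    ; Φ-cong = λ {φ} {ψ} → Φ-cong {φ} {ψ}
    ; Φ-hom  = Φ-hom
    ; Φ-inj  = λ {φ} {ψ} → Φ-injective {φ} {ψ}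
    ; Φ-surj = Φ-surjective
    }

theorem1 : (n : ℕ) .{{_ : NonZero n}} → 5 ≤ n → AutIso n
theorem1 (ℕ.suc (ℕ.suc (ℕ.suc (ℕ.suc (ℕ.suc k₀))))) (s≤s (s≤s (s≤s (s≤s (s≤s z≤n))))) = BubbleSort.aut-iso k₀
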